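{- Let $G$ be a simple graph with finite vertex set $V$, let $K=\{0,x,y,z\}$ be the Klein four-group, and for $P\subseteq V$ let $L_P\in K^V$ be defined by $L_P(v)=x$ if $v\in P\setminus N(P)$, $L_P(v)=y$ if $v\in N(P)\setminus P$, $L_P(v)=z$ if $v\in P\cap N(P)$, and $L_P(v)=0$ otherwise. Let $F\in\{x,y\}^V$, $F_x=F^{ -1}(x)$, $F_y=F^{ -1}(y)$, and $\widehat F=\{Y\in K^V: Y(v)\in\{0,F(v)\}\text{ for all }v\in V\}$. Then for $P\subseteq V$ the following are equivalent: (1) $L_P\in\widehat F$; (2) $P\subseteq F_x$, the induced subgraph $G\mid P$ is an even graph, and $N(P)\subseteq F_y$.
   Context: $K=\{0,x,y,z\}$ is the Klein four-group, identified with $\mathbb{Z}_2\times\mathbb{Z}_2$ via $0\leftrightarrow(0,0)$, $x\leftrightarrow(1,0)$, $y\leftrightarrow(0,1)$, $z\leftrightarrow(1,1)$; $K^V$ is the set of maps $V\to K$. For $v\in V$, $N(v)$ is the set of neighbours of $v$ in $G$; for $P\subseteq V$, $N(P)=\sum_{v\in P}N(v)$ (symmetric difference), i.e. the set of vertices adjacent to an odd number of vertices of $P$. $G\mid P$ is the subgraph induced by $P$; an even graph is one in which every vertex has even degree (not necessarily connected). Condition (2) is what the paper phrases as "$G\mid P$ is an even subgraph of $G\mid F_x$ and $N(P)\subseteq F_y$". -}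

module Defs where

open import Data.Nat using (ℕ; zero; suc; _+_)
open import Data.Bool using (Bool; true; false; _∧_; _xor_; not; if_then_else_)
open import Data.Fin using (Fin)
open import Data.Product using (_×_; _,_)
open import Relation.Binary.PropositionalEquality using (_≡_)
open import Data.Sum using (_⊎_)

record SimpleGraph (n : ℕ) : Set where
  field
    adj   : Fin n → Fin n → Bool
    sym   : ∀ u v → adj u v ≡ adj v u
    irrefl : ∀ v → adj v v ≡ false
open SimpleGraph public

Subset : ℕ → Set
Subset n = Fin n → Bool

_∈_ : ∀ {n} → Fin n → Subset n → Set
v ∈ P = P v ≡ true

_⊆_ : ∀ {n} → Subset n → Subset n → Set
P ⊆ Q = ∀ v → v ∈ P → v ∈ Q

count : ∀ {n} → (Fin n → Bool) → ℕ
count {zero}  f = 0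
count {suc n} f = (if f Fin.zero then 1 else 0) + count (λ i → f (Fin.suc i))

parity : ∀ {n} → (Fin n → Bool) → Bool
parity {zero}  f = false
parity {suc n} f = f Fin.zero xor parity (λ i → f (Fin.suc i))

Nbhd : ∀ {n} → SimpleGraph n → Fin n → Subset n
Nbhd G v u = adj G v u

-- N(P) = symmetric difference of N(v), v ∈ P:
-- vertices adjacent to an odd number of vertices of P.
NP : ∀ {n} → SimpleGraph n → Subset n → Subset n
NP G P v = parity (λ u → P u ∧ Nbhd G u v)

data Even : ℕ → Set where
  even-zero : Even zero
  even-ss   : ∀ {m} → Even m → Even (suc (suc m))

inducedDeg : ∀ {n} → SimpleGraph n → Subset n → Fin n → ℕ
inducedDeg G P v = count (λ u → P u ∧ adj G v u)

IsEvenInduced : ∀ {n} → SimpleGraph n → Subset n → Set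
IsEvenInduced G P = ∀ v → v ∈ P → Even (inducedDeg G P v)

data K : Set where
  k0 kx ky kz : K

data XY : Set where
  x y : XY

XY→K : XY → K
XY→K x = kx
XY→K y = ky

L : ∀ {n} → SimpleGraph n → Subset n → Fin n → K
L G P v with P v | NP G P v
... | true  | false = kx
... | false | true  = ky
... | true  | true  = kz
... | false | false = k0

_∈F̂_ : ∀ {n} → (Fin n → K) → (Fin n → XY) → Set
Y ∈F̂ F = ∀ v → (Y v ≡ k0) ⊎ (Y v ≡ XY→K (F v))

isX isY : XY → Bool
isX x = true
isX y = false
isY x = false
isY y = true

Fx Fy : ∀ {n} → (Fin n → XY) → Subset n
Fx F v = isX (F v)
Fy F v = isY (F v)

{-# OPTIONS --safe #-}
-- Since L_P(v) ∈ {0, F(v)} is a pointwise condition, it suffices to compare the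
-- two sides vertex by vertex: L_P(v) is allowed exactly when v ∉ P ∩ N(P),
-- v ∈ P forces F(v) = x and v ∈ N(P) forces F(v) = y. For v ∈ P, the condition
-- v ∉ N(P) says that v has an even number of neighbours in P, i.e. even degree
-- in G ∣ P.
module Submission where

open import Defs hiding (sym)
open import Data.Nat using (ℕ; zero; suc)
open import Data.Fin using (Fin)
open import Data.Bool using (Bool; true; false; not; _∧_; _xor_)
open import Data.Bool.Properties using (not-involutive)
open import Data.Product using (_×_; _,_; proj₁; proj₂)
open import Data.Sum using (_⊎_; inj₁; inj₂)
open import Function.Base using (case_of_)
open import Function.Bundles using (_⇔_; mk⇔; Equivalence)
open import Relation.Binary.PropositionalEquality
  using (_≡_; refl; sym; cong; cong₂; trans; subst)

isOdd : ℕ → Bool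
isOdd zero    = false
isOdd (suc m) = not (isOdd m)

isOdd≡false⇒Even : ∀ m → isOdd m ≡ false → Even m
isOdd≡false⇒Even zero          _ = even-zero
isOdd≡false⇒Even (suc (suc m)) h rewrite not-involutive (isOdd m) =
  even-ss (isOdd≡false⇒Even m h)

Even⇒isOdd≡false : ∀ {m} → Even m → isOdd m ≡ false
Even⇒isOdd≡false even-zero = refl
Even⇒isOdd≡false (even-ss {m} e) rewrite not-involutive (isOdd m) =
  Even⇒isOdd≡false e

isOdd≡false⇔Even : ∀ m → isOdd m ≡ false ⇔ Even m
isOdd≡false⇔Even m = mk⇔ (isOdd≡false⇒Even m) Even⇒isOdd≡false

parity≡isOdd-count : ∀ {n} (f : Fin n → Bool) → parity f ≡ isOdd (count f)
parity≡isOdd-count {zero}  f = refl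
parity≡isOdd-count {suc n} f with f Fin.zero
... | true  = cong not (parity≡isOdd-count (λ i → f (Fin.suc i)))
... | false = parity≡isOdd-count (λ i → f (Fin.suc i))

parity-cong : ∀ {n} {f g : Fin n → Bool} → (∀ i → f i ≡ g i) → parity f ≡ parity g
parity-cong {zero}  f≗g = refl
parity-cong {suc n} f≗g =
  cong₂ _xor_ (f≗g Fin.zero) (parity-cong (λ i → f≗g (Fin.suc i)))

module _ {n : ℕ} (G : SimpleGraph n) (P : Subset n) where

  NP≡isOdd-inducedDeg : ∀ v → NP G P v ≡ isOdd (inducedDeg G P v)
  NP≡isOdd-inducedDeg v =
    trans (parity-cong (λ u → cong (P u ∧_) (SimpleGraph.sym G u v)))
          (parity≡isOdd-count (λ u → P u ∧ adj G v u))

  NP≡false⇔Even-inducedDeg : ∀ v → NP G P v ≡ false ⇔ Even (inducedDeg G P v)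
  NP≡false⇔Even-inducedDeg v =
    subst (λ b → b ≡ false ⇔ Even (inducedDeg G P v))
          (sym (NP≡isOdd-inducedDeg v)) (isOdd≡false⇔Even (inducedDeg G P v))

  Condition2At : (Fin n → XY) → Fin n → Set
  Condition2At F v = (v ∈ P → v ∈ Fx F × NP G P v ≡ false) × (v ∈ NP G P → v ∈ Fy F)

  L-allowed⇔Condition2At : ∀ F v →
    (L G P v ≡ k0 ⊎ L G P v ≡ XY→K (F v)) ⇔ Condition2At F v
  L-allowed⇔Condition2At F v with P v | NP G P v | F v
  ... | false | false | _ = mk⇔ (λ _ → (λ ()) , (λ ())) (λ _ → inj₁ refl)
  ... | true  | false | x = mk⇔ (λ _ → (λ _ → refl , refl) , (λ ())) (λ _ → inj₂ refl)
  ... | false | true  | y = mk⇔ (λ _ → (λ ()) , (λ _ → refl)) (λ _ → inj₂ refl)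
  ... | true  | false | y = mk⇔ (λ { (inj₁ ()) ; (inj₂ ()) })
                                (λ c → case proj₁ (proj₁ c refl) of λ ())
  ... | false | true  | x = mk⇔ (λ { (inj₁ ()) ; (inj₂ ()) })
                                (λ c → case proj₂ c refl of λ ())
  ... | true  | true  | x = mk⇔ (λ { (inj₁ ()) ; (inj₂ ()) })
                                (λ c → case proj₂ (proj₁ c refl) of λ ())
  ... | true  | true  | y = mk⇔ (λ { (inj₁ ()) ; (inj₂ ()) })
                                (λ c → case proj₂ (proj₁ c refl) of λ ())

lemma4p2 : ∀ {n : ℕ} (G : SimpleGraph n) (F : Fin n → XY) (P : Subset n) →
    (L G P ∈F̂ F) ⇔ ((P ⊆ Fx F) × IsEvenInduced G P × (NP G P ⊆ Fy F))
lemma4p2 G F P = mk⇔ to from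
  where
  pointwise : ∀ v → (L G P v ≡ k0 ⊎ L G P v ≡ XY→K (F v)) ⇔ Condition2At G P F v
  pointwise = L-allowed⇔Condition2At G P F

  evenDeg⇔ : ∀ v → NP G P v ≡ false ⇔ Even (inducedDeg G P v)
  evenDeg⇔ = NP≡false⇔Even-inducedDeg G P

  to : L G P ∈F̂ F → (P ⊆ Fx F) × IsEvenInduced G P × (NP G P ⊆ Fy F)
  to L∈F̂ = (λ v v∈P → proj₁ (proj₁ (cond v) v∈P))
         , (λ v v∈P → Equivalence.to (evenDeg⇔ v) (proj₂ (proj₁ (cond v) v∈P)))
         , (λ v → proj₂ (cond v))
    where
    cond : ∀ v → Condition2At G P F v
    cond v = Equivalence.to (pointwise v) (L∈F̂ v)

  from : (P ⊆ Fx F) × IsEvenInduced G P × (NP G P ⊆ Fy F) → L G P ∈F̂ F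
  from (P⊆Fx , even , NP⊆Fy) v = Equivalence.from (pointwise v)
    ( (λ v∈P → P⊆Fx v v∈P , Equivalence.from (evenDeg⇔ v) (even v v∈P))
    , NP⊆Fy v )
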